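{- Every finite simple graph is an induced subgraph of some distance critical graph.
   Context: All graphs are finite, simple and undirected. For vertices $x,y$ of a graph $G$, $d_G(x,y)$ is the length of a shortest path from $x$ to $y$ in $G$ ($\infty$ if none exists). A graph $G$ is distance critical if for every vertex $v \in V(G)$ there exist vertices $x,y \in V(G)\setminus\{v\}$ with $d_G(x,y) \neq d_{G-v}(x,y)$. -}

module Defs where

open import Data.Nat using (ℕ; zero; suc; _≤_)
open import Data.Fin using (Fin; punchIn)
open import Data.Bool using (Bool; true; false)
open import Data.Maybe using (Maybe; just; nothing)
open import Data.Product using (Σ; _×_; ∃-syntax)
open import Data.Unit using (⊤)
open import Relation.Binary.PropositionalEquality using (_≡_; _≢_)
open import Relation.Nullary using (¬_)
open import Function.Definitions using (Injective)

record Graph (n : ℕ) : Set where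
  field
    adj    : Fin n → Fin n → Bool
    sym    : ∀ x y → adj x y ≡ adj y x
    irrefl : ∀ x → adj x x ≡ false
open Graph public

data Walk {n : ℕ} (G : Graph n) : Fin n → Fin n → ℕ → Set where
  here : ∀ {x} → Walk G x x 0
  step : ∀ {x y z k} → adj G x y ≡ true → Walk G y z k → Walk G x z (suc k)

-- Extended distance: just k = finite distance k, nothing = ∞.
-- IsDist G x y d : d is d_G(x,y), i.e. the length of a shortest x–y walk
-- (= shortest path), or ∞ if no walk exists.
IsDist : ∀ {n} → Graph n → Fin n → Fin n → Maybe ℕ → Set
IsDist G x y (just k) = Walk G x y k × (∀ j → Walk G x y j → k ≤ j)
IsDist G x y nothing  = ∀ j → ¬ Walk G x y j

-- G - v : delete vertex v; vertices of G - v are Fin m, embedded into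
-- V(G) ∖ {v} via the bijection punchIn v.
delete : ∀ {m} → Graph (suc m) → Fin (suc m) → Graph m
delete G v = record
  { adj    = λ x y → adj G (punchIn v x) (punchIn v y)
  ; sym    = λ x y → sym G (punchIn v x) (punchIn v y)
  ; irrefl = λ x → irrefl G (punchIn v x)
  }

DistanceCritical : ∀ {n} → Graph n → Set
DistanceCritical {zero}  G = ⊤
DistanceCritical {suc m} G =
  ∀ (v : Fin (suc m)) → ∃[ x ] ∃[ y ] ∃[ d ] ∃[ d′ ]
    (IsDist G (punchIn v x) (punchIn v y) d ×
     IsDist (delete G v) x y d′ ×
     d ≢ d′)

InducedSubgraph : ∀ {k n} → Graph k → Graph n → Set
InducedSubgraph {k} {n} H G =
  Σ (Fin k → Fin n) λ f → Injective _≡_ _≡_ f × (∀ i j → adj H i j ≡ adj G (f i) (f j))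

-- Glue a pentagon to every vertex of H at one of its corners. Every vertex v of the
-- resulting graph is then a corner of a pentagon v x a b y in which v is the only common
-- neighbour of its two pentagon neighbours x and y (all other pentagon vertices have degree
-- two). Hence d(x,y) = 2, while in G - v the remaining path x a b y gives d(x,y) = 3.
module Submission where

open import Defs hiding (sym)
open import Data.Bool using (Bool; true; false; _∧_; _∨_)
open import Data.Bool.Properties using (∨-comm) renaming (_≟_ to _≟ᵇ_)
open import Data.Empty using (⊥)
open import Data.Fin using (Fin; zero; suc; punchIn; punchOut; combine; remQuot; _≟_)
open import Data.Fin.Properties
  using (punchIn-punchOut; punchInᵢ≢i; remQuot-combine; combine-injective; combine-surjective; all?)
open import Data.Maybe using (just)
open import Data.Nat using (ℕ; zero; suc; _*_; _≤_; z≤n; s≤s)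
open import Data.Product using (Σ; _×_; _,_; proj₁; proj₂; ∃-syntax)
open import Function.Bundles using (mk⇔)
open import Function.Definitions using (Injective)
open import Relation.Binary.PropositionalEquality
open import Relation.Nullary using (does; yes; no; contradiction)
open import Relation.Nullary.Decidable using (from-yes; _→-dec_; dec-true; does-⇔)

module _ {n : ℕ} (G : Graph n) where

  adjacent⇒≢ : ∀ {x y} → adj G x y ≡ true → x ≢ y
  adjacent⇒≢ {x} x∼x refl with () ← trans (sym x∼x) (irrefl G x)

  isDist-two : ∀ {x v y} → x ≢ y → adj G x y ≡ false →
    adj G x v ≡ true → adj G v y ≡ true → IsDist G x y (just 2)
  isDist-two {x} {v} {y} x≢y x≁y x∼v v∼y = step x∼v (step v∼y here) , shortest
    where
    shortest : ∀ j → Walk G x y j → 2 ≤ j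
    shortest _ here                  = contradiction refl x≢y
    shortest _ (step x∼y here)       with () ← trans (sym x∼y) x≁y
    shortest _ (step _ (step _ _))   = s≤s (s≤s z≤n)

  isDist-three : ∀ {x a b y} → x ≢ y → adj G x y ≡ false →
    (∀ w → adj G x w ≡ true → adj G w y ≡ true → ⊥) →
    adj G x a ≡ true → adj G a b ≡ true → adj G b y ≡ true → IsDist G x y (just 3)
  isDist-three {x} {a} {b} {y} x≢y x≁y noCommon x∼a a∼b b∼y =
    step x∼a (step a∼b (step b∼y here)) , shortest
    where
    shortest : ∀ j → Walk G x y j → 3 ≤ j
    shortest _ here                         = contradiction refl x≢y
    shortest _ (step x∼y here)              with () ← trans (sym x∼y) x≁y
    shortest _ (step x∼w (step w∼y here))   with () ← noCommon _ x∼w w∼y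
    shortest _ (step _ (step _ (step _ _))) = s≤s (s≤s (s≤s z≤n))

OnlyCommonNeighbour : ∀ {n} → Graph n → Fin n → Fin n → Fin n → Set
OnlyCommonNeighbour G x y v = ∀ w → adj G x w ≡ true → adj G w y ≡ true → w ≡ v

record Pentagon {n} (G : Graph n) (v x a b y : Fin n) : Set where
  constructor pentagon
  field
    x∼v : adj G x v ≡ true
    v∼y : adj G v y ≡ true
    x∼a : adj G x a ≡ true
    a∼b : adj G a b ≡ true
    b∼y : adj G b y ≡ true
    x≁y : adj G x y ≡ false
    v≢a : v ≢ a
    v≢b : v ≢ b

PentagonCorner : ∀ {n} → Graph n → Fin n → Set
PentagonCorner G v =
  ∃[ x ] ∃[ a ] ∃[ b ] ∃[ y ] (Pentagon G v x a b y × OnlyCommonNeighbour G x y v)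

-- Otherwise a would be a common neighbour of x = y.
pentagon-x≢y : ∀ {n} {G : Graph n} {v x a b y} →
  Pentagon G v x a b y → OnlyCommonNeighbour G x y v → x ≢ y
pentagon-x≢y {G = G} {x = x} {a = a} (pentagon _ _ x∼a _ _ _ v≢a _) only refl =
  v≢a (sym (only a x∼a (trans (Graph.sym G a x) x∼a)))

CriticalVertex : ∀ {m} → Graph (suc m) → Fin (suc m) → Set
CriticalVertex G v = ∃[ x ] ∃[ y ] ∃[ d ] ∃[ d′ ]
  (IsDist G (punchIn v x) (punchIn v y) d × IsDist (delete G v) x y d′ × d ≢ d′)

delete-adj : ∀ {m} (G : Graph (suc m)) {v x y} (v≢x : v ≢ x) (v≢y : v ≢ y) →
  adj (delete G v) (punchOut v≢x) (punchOut v≢y) ≡ adj G x y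
delete-adj G v≢x v≢y = cong₂ (adj G) (punchIn-punchOut v≢x) (punchIn-punchOut v≢y)

pentagonCorner⇒criticalVertex : ∀ {m} (G : Graph (suc m)) {v} →
  PentagonCorner G v → CriticalVertex G v
pentagonCorner⇒criticalVertex G {v} (x , a , b , y , P , only) =
  punchOut v≢x , punchOut v≢y , just 2 , just 3 ,
  subst₂ (λ p q → IsDist G p q (just 2)) (sym ↑x) (sym ↑y) (isDist-two G x≢y x≁y x∼v v∼y) ,
  isDist-three (delete G v) (λ x′≡y′ → x≢y (trans (sym ↑x) (trans (cong (punchIn v) x′≡y′) ↑y)))
    (trans (delete-adj G v≢x v≢y) x≁y) noCommonNeighbour
    (trans (delete-adj G v≢x v≢a) x∼a) (trans (delete-adj G v≢a v≢b) a∼b)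
    (trans (delete-adj G v≢b v≢y) b∼y) ,
  λ ()
  where
  open Pentagon P
  x≢y : x ≢ y
  x≢y = pentagon-x≢y P only
  v≢x : v ≢ x
  v≢x = ≢-sym (adjacent⇒≢ G x∼v)
  v≢y : v ≢ y
  v≢y = adjacent⇒≢ G v∼y
  ↑x : punchIn v (punchOut v≢x) ≡ x
  ↑x = punchIn-punchOut v≢x
  ↑y : punchIn v (punchOut v≢y) ≡ y
  ↑y = punchIn-punchOut v≢y
  noCommonNeighbour : ∀ w → adj (delete G v) (punchOut v≢x) w ≡ true →
    adj (delete G v) w (punchOut v≢y) ≡ true → ⊥
  noCommonNeighbour w x∼w w∼y = punchInᵢ≢i v w (only (punchIn v w)
    (subst (λ p → adj G p (punchIn v w) ≡ true) ↑x x∼w)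
    (subst (λ q → adj G (punchIn v w) q ≡ true) ↑y w∼y))

pentagonCorners⇒distanceCritical : ∀ {n} (G : Graph n) →
  (∀ v → PentagonCorner G v) → DistanceCritical G
pentagonCorners⇒distanceCritical {zero}  G _       = _
pentagonCorners⇒distanceCritical {suc m} G corner v = pentagonCorner⇒criticalVertex G (corner v)

module _ {k n} {H : Graph k} {G : Graph n} (embedding : InducedSubgraph H G) where

  private
    f : Fin k → Fin n
    f = proj₁ embedding
    f-injective : Injective _≡_ _≡_ f
    f-injective = proj₁ (proj₂ embedding)
    f-adj : ∀ i j → adj H i j ≡ adj G (f i) (f j)
    f-adj = proj₂ (proj₂ embedding)

  pentagon-embed : ∀ {v x a b y} → Pentagon H v x a b y → Pentagon G (f v) (f x) (f a) (f b) (f y)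
  pentagon-embed (pentagon x∼v v∼y x∼a a∼b b∼y x≁y v≢a v≢b) = pentagon
    (edge x∼v) (edge v∼y) (edge x∼a) (edge a∼b) (edge b∼y) (edge x≁y)
    (λ fv≡fa → v≢a (f-injective fv≡fa)) (λ fv≡fb → v≢b (f-injective fv≡fb))
    where
    edge : ∀ {i j e} → adj H i j ≡ e → adj G (f i) (f j) ≡ e
    edge {i} {j} i∼j = trans (sym (f-adj i j)) i∼j

  onlyCommonNeighbour-embed : ∀ {x y v} → OnlyCommonNeighbour H x y v →
    (∀ w → adj G (f x) w ≡ true → adj G w (f y) ≡ true → ∃[ u ] w ≡ f u) →
    OnlyCommonNeighbour G (f x) (f y) (f v)
  onlyCommonNeighbour-embed {x} {y} only inImage w fx∼w w∼fy with inImage w fx∼w w∼fy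
  ... | u , refl = cong f (only u (trans (f-adj x u) fx∼w) (trans (f-adj u y) w∼fy))

next previous : Fin 5 → Fin 5
next zero                         = suc zero
next (suc zero)                   = suc (suc zero)
next (suc (suc zero))             = suc (suc (suc zero))
next (suc (suc (suc zero)))       = suc (suc (suc (suc zero)))
next (suc (suc (suc (suc zero)))) = zero
previous zero                         = suc (suc (suc (suc zero)))
previous (suc zero)                   = zero
previous (suc (suc zero))             = suc zero
previous (suc (suc (suc zero)))       = suc (suc zero)
previous (suc (suc (suc (suc zero)))) = suc (suc (suc zero))

cycleAdj : Fin 5 → Fin 5 → Bool
cycleAdj c d = does (d ≟ next c) ∨ does (c ≟ next d)

C₅ : Graph 5
C₅ = record
  { adj    = cycleAdj
  ; sym    = λ c d → ∨-comm (does (d ≟ next c)) (does (c ≟ next d))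
  ; irrefl = from-yes (all? λ c → cycleAdj c c ≟ᵇ false)
  }

pentagon-C₅ : ∀ c → Pentagon C₅ c (previous c) (previous (previous c)) (next (next c)) (next c)
pentagon-C₅ zero                         = pentagon refl refl refl refl refl refl (λ ()) (λ ())
pentagon-C₅ (suc zero)                   = pentagon refl refl refl refl refl refl (λ ()) (λ ())
pentagon-C₅ (suc (suc zero))             = pentagon refl refl refl refl refl refl (λ ()) (λ ())
pentagon-C₅ (suc (suc (suc zero)))       = pentagon refl refl refl refl refl refl (λ ()) (λ ())
pentagon-C₅ (suc (suc (suc (suc zero)))) = pentagon refl refl refl refl refl refl (λ ()) (λ ())

onlyCommonNeighbour-C₅ : ∀ c → OnlyCommonNeighbour C₅ (previous c) (next c) c
onlyCommonNeighbour-C₅ = from-yes (all? λ c → all? λ w →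
  (cycleAdj (previous c) w ≟ᵇ true) →-dec (cycleAdj w (next c) ≟ᵇ true) →-dec (w ≟ c))

module PentagonGluing {k : ℕ} (H : Graph k) where

  fibreAdj : Fin k → Fin k → Fin 5 → Fin 5 → Bool
  fibreAdj i j c d = does (i ≟ j) ∧ cycleAdj c d

  -- (i , zero) is vertex i of H, and (i , c) runs around the pentagon glued to it.
  gluedAdj : Fin k × Fin 5 → Fin k × Fin 5 → Bool
  gluedAdj (i , zero)  (j , zero)  = adj H i j
  gluedAdj (i , zero)  (j , suc d) = fibreAdj i j zero (suc d)
  gluedAdj (i , suc c) (j , d)     = fibreAdj i j (suc c) d

  fibreAdj-sym : ∀ i j c d → fibreAdj i j c d ≡ fibreAdj j i d c
  fibreAdj-sym i j c d = cong₂ _∧_ (does-⇔ (mk⇔ sym sym) (i ≟ j) (j ≟ i)) (Graph.sym C₅ c d)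

  gluedAdj-sym : ∀ p q → gluedAdj p q ≡ gluedAdj q p
  gluedAdj-sym (i , zero)  (j , zero)  = Graph.sym H i j
  gluedAdj-sym (i , zero)  (j , suc d) = fibreAdj-sym i j zero (suc d)
  gluedAdj-sym (i , suc c) (j , zero)  = fibreAdj-sym i j (suc c) zero
  gluedAdj-sym (i , suc c) (j , suc d) = fibreAdj-sym i j (suc c) (suc d)

  gluedAdj-fibre : ∀ i c d → gluedAdj (i , c) (i , d) ≡ cycleAdj c d
  gluedAdj-fibre i zero    zero    = irrefl H i
  gluedAdj-fibre i zero    (suc d) = cong (_∧ cycleAdj zero (suc d)) (dec-true (i ≟ i) refl)
  gluedAdj-fibre i (suc c) d       = cong (_∧ cycleAdj (suc c) d) (dec-true (i ≟ i) refl)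

  fibreAdj⇒≡ : ∀ i j c d → fibreAdj i j c d ≡ true → i ≡ j
  fibreAdj⇒≡ i j c d i∼j with i ≟ j
  ... | yes i≡j = i≡j
  fibreAdj⇒≡ i j c d () | no _

  -- Only the hub (i , zero) of a pentagon has neighbours outside it.
  sameFibre : ∀ {i j p q d} → p ≢ q →
    gluedAdj (i , p) (j , d) ≡ true → gluedAdj (j , d) (i , q) ≡ true → i ≡ j
  sameFibre {p = zero}  {zero}  p≢q _ _ = contradiction refl p≢q
  sameFibre {i} {j} {zero} {suc q} {d} _ _ w∼y =
    fibreAdj⇒≡ i j (suc q) d (trans (gluedAdj-sym (i , suc q) (j , d)) w∼y)
  sameFibre {i} {j} {suc p} {_} {d} _ x∼w _ = fibreAdj⇒≡ i j (suc p) d x∼w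

  G : Graph (k * 5)
  G = record
    { adj    = λ u w → gluedAdj (remQuot 5 u) (remQuot 5 w)
    ; sym    = λ u w → gluedAdj-sym (remQuot 5 u) (remQuot 5 w)
    ; irrefl = λ u → let (i , c) = remQuot 5 u in trans (gluedAdj-fibre i c c) (irrefl C₅ c)
    }

  adj-combine : ∀ i c j d → adj G (combine i c) (combine j d) ≡ gluedAdj (i , c) (j , d)
  adj-combine i c j d = cong₂ gluedAdj (remQuot-combine i c) (remQuot-combine j d)

  root : InducedSubgraph H G
  root = (λ i → combine i zero)
       , (λ {i} {j} e → proj₁ (combine-injective i zero j zero e))
       , (λ i j → sym (adj-combine i zero j zero))

  fibre : Fin k → InducedSubgraph C₅ G
  fibre i = combine i
          , (λ {c} {d} e → proj₂ (combine-injective i c i d e))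
          , (λ c d → sym (trans (adj-combine i c i d) (gluedAdj-fibre i c d)))

  commonNeighbour-inFibre : ∀ i {p q} → p ≢ q → ∀ w →
    adj G (combine i p) w ≡ true → adj G w (combine i q) ≡ true → ∃[ d ] w ≡ combine i d
  commonNeighbour-inFibre i {p} {q} p≢q w x∼w w∼y with combine-surjective {k} w
  ... | j , d , refl = d , cong (λ j → combine j d) (sym i≡j)
    where
    i≡j : i ≡ j
    i≡j = sameFibre p≢q (trans (sym (adj-combine i p j d)) x∼w) (trans (sym (adj-combine j d i q)) w∼y)

  pentagonCorner : ∀ v → PentagonCorner G v
  pentagonCorner v with combine-surjective {k} v
  ... | i , c , refl = _ , _ , _ , _
    , pentagon-embed {H = C₅} (fibre i) (pentagon-C₅ c)
    , onlyCommonNeighbour-embed {H = C₅} {G = G} (fibre i) (onlyCommonNeighbour-C₅ c)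
        (commonNeighbour-inFibre i (pentagon-x≢y (pentagon-C₅ c) (onlyCommonNeighbour-C₅ c)))

theorem5p9 : ∀ (k : ℕ) (H : Graph k) →
    ∃[ n ] Σ (Graph n) λ G → DistanceCritical G × InducedSubgraph H G
theorem5p9 k H = k * 5 , G , pentagonCorners⇒distanceCritical G pentagonCorner , root
  where open PentagonGluing H
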